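{- Let $\Theta_1$ and $\Theta_2$ be two distinct commuting involutive antimorphisms on $\mathcal{A}^*$ such that the morphism $\Theta_1\Theta_2$ fixes no letter of $\mathcal{A}$ (i.e., its restriction to $\mathcal{A}$ is a derangement). If $\mathbf{u}$ is an infinite word with language closed under $\Theta_1$ and $\Theta_2$, then $$\Delta\mathcal{C}(n)+4\ge \mathcal{P}_{\Theta_1}(n)+\mathcal{P}_{\Theta_2}(n)+\mathcal{P}_{\Theta_1}(n+1)+\mathcal{P}_{\Theta_2}(n+1)\quad\text{for all } n\ge 1.$$
   Context: An antimorphism on $\mathcal{A}^*$ is a map $\Theta$ with $\Theta(vw)=\Theta(w)\Theta(v)$; involutive means $\Theta^2=\mathrm{Id}$. $\mathcal{L}_n(\mathbf{u})$ is the set of factors of $\mathbf{u}$ of length $n$; the language is closed under $\Theta$ if $\Theta$ maps factors of $\mathbf{u}$ to factors of $\mathbf{u}$. $\mathcal{C}(n)=\#\mathcal{L}_n(\mathbf{u})$, $\Delta\mathcal{C}(n)=\mathcal{C}(n+1)-\mathcal{C}(n)$, and $\mathcal{P}_\Theta(n)=\#\{w\in\mathcal{L}_n(\mathbf{u}) \mid \Theta(w)=w\}$. The alphabet $\mathcal{A}$ consists exactly of the letters occurring in $\mathbf{u}$. -}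

module Defs where

open import Data.Nat using (ℕ; zero; suc; _+_; _≤_)
open import Data.Fin using (Fin)
import Data.Fin.Properties as FinP
open import Data.List using (List; []; _∷_; [_]; _++_; length; filter)
open import Data.List.Properties using (≡-dec)
open import Data.List.Membership.Propositional using (_∈_)
open import Data.List.Relation.Unary.Unique.Propositional using (Unique)
open import Data.Product using (Σ; ∃; _×_)
open import Relation.Binary.PropositionalEquality using (_≡_)
open import Relation.Nullary using (¬_)
open import Function.Bundles using (_⇔_)

Word∞ : ℕ → Set
Word∞ k = ℕ → Fin k

window : ∀ {k} → Word∞ k → ℕ → ℕ → List (Fin k)
window u i zero = []
window u i (suc n) = u i ∷ window u (suc i) n

Factor : ∀ {k} → Word∞ k → List (Fin k) → Set
Factor u w = ∃ λ i → w ≡ window u i (length w)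

AllLettersOccur : ∀ {k} → Word∞ k → Set
AllLettersOccur {k} u = (a : Fin k) → ∃ λ i → u i ≡ a

IsAntimorphism : ∀ {k} → (List (Fin k) → List (Fin k)) → Set
IsAntimorphism Θ = ∀ v w → Θ (v ++ w) ≡ Θ w ++ Θ v

IsInvolutive : ∀ {k} → (List (Fin k) → List (Fin k)) → Set
IsInvolutive Θ = ∀ w → Θ (Θ w) ≡ w

ClosedUnder : ∀ {k} → Word∞ k → (List (Fin k) → List (Fin k)) → Set
ClosedUnder u Θ = ∀ w → Factor u w → Factor u (Θ w)

-- L is a duplicate-free enumeration of L_n(u); its length is C(n)
Enumerates : ∀ {k} → Word∞ k → ℕ → List (List (Fin k)) → Set
Enumerates u n L = Unique L × (∀ w → (w ∈ L) ⇔ (length w ≡ n × Factor u w))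

-- number of Θ-palindromes in the list L (P_Θ(n) when L enumerates L_n(u))
palCount : ∀ {k} → (List (Fin k) → List (Fin k)) → List (List (Fin k)) → ℕ
palCount Θ L = length (filter (λ w → ≡-dec FinP._≟_ (Θ w) w) L)

-- Θ₁ and Θ₂ generate a Klein four-group G = {id, Θ₁, Θ₂, Θ₁Θ₂} acting on the factors of u
-- of each length. As Θ₁Θ₂ is a morphism fixing no letter, it fixes no nonempty word, so the
-- stabiliser of a factor w has 1 + [Θ₁ w = w] + [Θ₂ w = w] elements. Summing stabiliser sizes
-- over an orbit gives |G| = 4, hence C(n) + P_Θ₁(n) + P_Θ₂(n) = 4 · #(orbits of L_n(u)), and
-- C(n+1) - P_Θ₁(n+1) - P_Θ₂(n+1) = 4 · #(orbits of (n+1)-factors fixed by neither Θᵢ).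
-- Now walk along u through the Rauzy graph of order n. The first visit of a vertex orbit
-- (other than that of the starting vertex) happens through an edge whose orbit was never
-- crossed before, and that edge is fixed by neither Θᵢ: an edge e with Θᵢ e = e has Θᵢ mapping
-- its prefix onto its suffix, so both ends lie in one orbit. Since u visits every vertex,
-- #(vertex orbits) ≤ 1 + #(edge orbits fixed by neither Θᵢ); multiply by 4.
module Submission where

open import Defs
open import Data.Bool using (Bool; true; false; _xor_)
open import Data.Bool.Properties using (xor-comm; xor-same)
open import Data.Empty using (⊥)
open import Data.Fin using (Fin)
import Data.Fin.Properties as FinP
open import Data.List using (List; []; _∷_; [_]; _++_; length; filter)
open import Data.List.Properties using (≡-dec; length-++; ∷-injective; ∷-injectiveʳ)
open import Data.List.Membership.Propositional using (_∈_; _∉_)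
open import Data.List.Relation.Unary.Any using (here; there)
open import Data.List.Relation.Unary.Unique.Propositional using (Unique; _∷_)
open import Data.List.Relation.Unary.Unique.Propositional.Properties using (Unique[x∷xs]⇒x∉xs)
open import Data.Nat using (ℕ; zero; suc; _+_; _≤_; _⊔_; z≤n; s≤s; _≤′_; ≤′-refl; ≤′-step)
open import Data.Nat.Properties
  using (+-commutativeSemigroup; +-comm; +-assoc; +-identityʳ; +-suc; +-mono-≤; +-monoˡ-≤;
         +-monoʳ-≤; m≤m+n; m≤n+m; m≤m⊔n; m≤n⊔m; ≤-reflexive; ≤-trans; ≤-antisym; ≤⇒≤′;
         m+1+n≢m; suc-injective; module ≤-Reasoning)
open import Algebra.Properties.CommutativeSemigroup +-commutativeSemigroup using (interchange)
open import Data.Product using (∃; _×_; _,_; proj₁; proj₂; map₁)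
open import Data.Sum using (_⊎_; inj₁; inj₂)
open import Function using (id; _∘_; Equivalence)
open import Relation.Binary.Definitions using (DecidableEquality)
open import Relation.Binary.PropositionalEquality
  using (_≡_; _≢_; refl; sym; trans; cong; cong₂; subst; module ≡-Reasoning)
open import Relation.Nullary using (¬_; Dec; yes; no; contradiction)
open import Relation.Nullary.Decidable using (¬?; _⊎-dec_; map′)

∑ : {A : Set} → List A → (A → ℕ) → ℕ
∑ []       f = 0
∑ (x ∷ xs) f = f x + ∑ xs f

syntax ∑ xs (λ x → e) = ∑[ x ∈ xs ] e

𝟙 : {P : Set} → Dec P → ℕ
𝟙 (yes _) = 1
𝟙 (no _)  = 0

module _ {A : Set} where

  ∑-+ : (xs : List A) (f g : A → ℕ) → ∑[ x ∈ xs ] (f x + g x) ≡ ∑ xs f + ∑ xs g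
  ∑-+ []       f g = refl
  ∑-+ (x ∷ xs) f g = trans (cong (f x + g x +_) (∑-+ xs f g)) (interchange (f x) (g x) (∑ xs f) (∑ xs g))

  ∑-zero : (xs : List A) → ∑[ x ∈ xs ] 0 ≡ 0
  ∑-zero []       = refl
  ∑-zero (x ∷ xs) = ∑-zero xs

  ∑-one : (xs : List A) → ∑[ x ∈ xs ] 1 ≡ length xs
  ∑-one []       = refl
  ∑-one (x ∷ xs) = cong suc (∑-one xs)

  ∑-cong : (xs : List A) {f g : A → ℕ} → (∀ {x} → x ∈ xs → f x ≡ g x) → ∑ xs f ≡ ∑ xs g
  ∑-cong []       f≡g = refl
  ∑-cong (x ∷ xs) f≡g = cong₂ _+_ (f≡g (here refl)) (∑-cong xs (f≡g ∘ there))

  ∑-mono-≤ : (xs : List A) {f g : A → ℕ} → (∀ {x} → x ∈ xs → f x ≤ g x) → ∑ xs f ≤ ∑ xs g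
  ∑-mono-≤ []       f≤g = z≤n
  ∑-mono-≤ (x ∷ xs) f≤g = +-mono-≤ (f≤g (here refl)) (∑-mono-≤ xs (f≤g ∘ there))

  length-filter≡∑𝟙 : {P : A → Set} (P? : ∀ x → Dec (P x)) (xs : List A) →
                     length (filter P? xs) ≡ ∑[ x ∈ xs ] 𝟙 (P? x)
  length-filter≡∑𝟙 P? []       = refl
  length-filter≡∑𝟙 P? (x ∷ xs) with P? x
  ... | yes _ = cong suc (length-filter≡∑𝟙 P? xs)
  ... | no _  = length-filter≡∑𝟙 P? xs

  module _ (_≟_ : DecidableEquality A) where

    ∑-𝟙-∉ : ∀ {z} (xs : List A) → z ∉ xs → ∑[ x ∈ xs ] 𝟙 (x ≟ z) ≡ 0
    ∑-𝟙-∉ []       z∉ = refl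
    ∑-𝟙-∉ {z} (x ∷ xs) z∉ with x ≟ z
    ... | yes refl = contradiction (here refl) z∉
    ... | no _     = ∑-𝟙-∉ xs (z∉ ∘ there)

    ∑-𝟙-∈ : ∀ {z} (xs : List A) → Unique xs → z ∈ xs → ∑[ x ∈ xs ] 𝟙 (x ≟ z) ≡ 1
    ∑-𝟙-∈ {z} (x ∷ xs) uniq z∈ with x ≟ z
    ∑-𝟙-∈ (x ∷ xs) uniq z∈          | yes refl = cong suc (∑-𝟙-∉ xs (Unique[x∷xs]⇒x∉xs uniq))
    ∑-𝟙-∈ (x ∷ xs) uniq (here x≡z)  | no x≢z   = contradiction (sym x≡z) x≢z
    ∑-𝟙-∈ (x ∷ xs) (_ ∷ uniq) (there z∈) | no _ = ∑-𝟙-∈ xs uniq z∈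

𝟙-cong : {P Q : Set} (p? : Dec P) (q? : Dec Q) → (P → Q) → (Q → P) → 𝟙 p? ≡ 𝟙 q?
𝟙-cong (yes p) (yes q) P→Q Q→P = refl
𝟙-cong (yes p) (no ¬q) P→Q Q→P = contradiction (P→Q p) ¬q
𝟙-cong (no ¬p) (yes q) P→Q Q→P = contradiction (Q→P q) ¬p
𝟙-cong (no ¬p) (no ¬q) P→Q Q→P = refl

𝟙-yes : {P : Set} (p? : Dec P) → P → 𝟙 p? ≡ 1
𝟙-yes (yes _) p = refl
𝟙-yes (no ¬p) p = contradiction p ¬p

𝟙-no : {P : Set} (p? : Dec P) → ¬ P → 𝟙 p? ≡ 0
𝟙-no (yes p) ¬p = contradiction p ¬p
𝟙-no (no _)  ¬p = refl

++-injective : {A : Set} (xs xs′ : List A) {ys ys′ : List A} →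
               length xs ≡ length xs′ → xs ++ ys ≡ xs′ ++ ys′ → xs ≡ xs′ × ys ≡ ys′
++-injective []       []         _   eq = refl , eq
++-injective (x ∷ xs) (x′ ∷ xs′) len eq with ∷-injective eq
... | refl , eq′ = map₁ (cong (x ∷_)) (++-injective xs xs′ (suc-injective len) eq′)

uniform-bound : {A : Set} {P : ℕ → A → Set} → (∀ {i j x} → i ≤ j → P i x → P j x) →
                (xs : List A) → (∀ {x} → x ∈ xs → ∃ λ i → P i x) →
                ∃ λ T → ∀ {x} → x ∈ xs → P T x
uniform-bound mono []       bound = 0 , λ ()
uniform-bound mono (x ∷ xs) bound with bound (here refl) | uniform-bound mono xs (bound ∘ there)
... | i , Pix | T , Pxs = i ⊔ T , λ { (here refl) → mono (m≤m⊔n i T) Pix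
                                    ; (there x∈) → mono (m≤n⊔m i T) (Pxs x∈) }

_^ᵇ_ : {A : Set} → (A → A) → Bool → A → A
f ^ᵇ false = id
f ^ᵇ true  = f

module _ {A : Set} {f : A → A} where

  ^ᵇ-xor : (∀ x → f (f x) ≡ x) → ∀ b c x → (f ^ᵇ (b xor c)) x ≡ (f ^ᵇ b) ((f ^ᵇ c) x)
  ^ᵇ-xor inv false c     x = refl
  ^ᵇ-xor inv true  false x = refl
  ^ᵇ-xor inv true  true  x = sym (inv x)

  ^ᵇ-comm : {g : A → A} → (∀ x → f (g x) ≡ g (f x)) →
            ∀ b c x → (f ^ᵇ b) ((g ^ᵇ c) x) ≡ (g ^ᵇ c) ((f ^ᵇ b) x)
  ^ᵇ-comm comm false c     x = refl
  ^ᵇ-comm comm true  false x = refl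
  ^ᵇ-comm comm true  true  x = comm x

  ^ᵇ-preserves : (P : A → Set) → (∀ {x} → P x → P (f x)) → ∀ b {x} → P x → P ((f ^ᵇ b) x)
  ^ᵇ-preserves P pres false Px = Px
  ^ᵇ-preserves P pres true  Px = pres Px

G : Set
G = Bool × Bool

_·_ : G → G → G
(b₁ , b₂) · (c₁ , c₂) = b₁ xor c₁ , b₂ xor c₂

·-comm : ∀ g h → g · h ≡ h · g
·-comm (b₁ , b₂) (c₁ , c₂) = cong₂ _,_ (xor-comm b₁ c₁) (xor-comm b₂ c₂)

·-self : ∀ g → g · g ≡ (false , false)
·-self (b₁ , b₂) = cong₂ _,_ (xor-same b₁) (xor-same b₂)

∃-G? : {P : G → Set} → (∀ g → Dec (P g)) → Dec (∃ P)
∃-G? {P} P? = map′ (λ { (inj₁ (inj₁ p)) → _ , p ; (inj₁ (inj₂ p)) → _ , p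
                      ; (inj₂ (inj₁ p)) → _ , p ; (inj₂ (inj₂ p)) → _ , p })
                   (λ { ((false , false) , p) → inj₁ (inj₁ p) ; ((false , true) , p) → inj₁ (inj₂ p)
                      ; ((true , false) , p) → inj₂ (inj₁ p) ; ((true , true) , p) → inj₂ (inj₂ p) })
                   ((P? (false , false) ⊎-dec P? (false , true)) ⊎-dec
                    (P? (true , false) ⊎-dec P? (true , true)))

∑𝔹 : (Bool → ℕ) → ℕ
∑𝔹 F = F false + F true

∑G : (G → ℕ) → ℕ
∑G F = ∑𝔹 λ b₁ → ∑𝔹 λ b₂ → F (b₁ , b₂)

∑𝔹-xor : ∀ b (F : Bool → ℕ) → ∑𝔹 (λ c → F (b xor c)) ≡ ∑𝔹 F
∑𝔹-xor false F = refl
∑𝔹-xor true  F = +-comm (F true) (F false)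

∑G-· : ∀ h (F : G → ℕ) → ∑G (λ g → F (h · g)) ≡ ∑G F
∑G-· (b₁ , b₂) F = begin
  ∑𝔹 (λ c₁ → ∑𝔹 λ c₂ → F (b₁ xor c₁ , b₂ xor c₂))
    ≡⟨ cong₂ _+_ (∑𝔹-xor b₂ (λ c₂ → F (b₁ xor false , c₂)))
                 (∑𝔹-xor b₂ (λ c₂ → F (b₁ xor true , c₂))) ⟩
  ∑𝔹 (λ c₁ → ∑𝔹 λ c₂ → F (b₁ xor c₁ , c₂))
    ≡⟨ ∑𝔹-xor b₁ (λ c₁ → ∑𝔹 λ c₂ → F (c₁ , c₂)) ⟩
  ∑G F ∎
  where open ≡-Reasoning

∑G-cong : {F F′ : G → ℕ} → (∀ g → F g ≡ F′ g) → ∑G F ≡ ∑G F′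
∑G-cong F≡F′ = cong₂ _+_ (cong₂ _+_ (F≡F′ _) (F≡F′ _)) (cong₂ _+_ (F≡F′ _) (F≡F′ _))

∑-∑G : {A : Set} (xs : List A) (F : A → G → ℕ) → ∑[ x ∈ xs ] ∑G (F x) ≡ ∑G λ g → ∑[ x ∈ xs ] F x g
∑-∑G xs F = trans (∑-∑𝔹 (λ x b₁ → ∑𝔹 λ b₂ → F x (b₁ , b₂)))
                  (cong₂ _+_ (∑-∑𝔹 (λ x b₂ → F x (false , b₂))) (∑-∑𝔹 (λ x b₂ → F x (true , b₂))))
  where
  ∑-∑𝔹 : (H : _ → Bool → ℕ) → ∑[ x ∈ xs ] ∑𝔹 (H x) ≡ ∑𝔹 λ b → ∑[ x ∈ xs ] H x b
  ∑-∑𝔹 H = ∑-+ xs (λ x → H x false) (λ x → H x true)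

Word : ℕ → Set
Word k = List (Fin k)

_≟_ : ∀ {k} → DecidableEquality (Word k)
_≟_ = ≡-dec FinP._≟_

IsMorphism : ∀ {k} → (Word k → Word k) → Set
IsMorphism Φ = ∀ v w → Φ (v ++ w) ≡ Φ v ++ Φ w

antimorphism-∘ : ∀ {k} (Θ Θ′ : Word k → Word k) →
                 IsAntimorphism Θ → IsAntimorphism Θ′ → IsMorphism (Θ ∘ Θ′)
antimorphism-∘ Θ Θ′ anti anti′ v w =
  trans (cong Θ (anti′ v w)) (anti (Θ′ w) (Θ′ v))

module InvolutiveAntimorphism {k} (Θ : Word k → Word k)
  (anti : IsAntimorphism Θ) (inv : IsInvolutive Θ) where

  -- Θ [] = Θ [] ++ Θ [] leaves no room for a letter.
  Θ-[] : Θ [] ≡ []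
  Θ-[] with Θ [] in eq
  ... | []     = refl
  ... | a ∷ as = contradiction
        (sym (trans (cong length (trans (sym eq) (trans (anti [] []) (cong₂ _++_ eq eq))))
                    (length-++ (a ∷ as))))
        (m+1+n≢m (length (a ∷ as)))

  1≤length-Θ-letter : ∀ a → 1 ≤ length (Θ [ a ])
  1≤length-Θ-letter a with Θ [ a ] in eq
  ... | []    = contradiction (trans (sym (inv [ a ])) (trans (cong Θ eq) Θ-[])) λ ()
  ... | _ ∷ _ = s≤s z≤n

  length≤length-Θ : ∀ w → length w ≤ length (Θ w)
  length≤length-Θ []      = z≤n
  length≤length-Θ (a ∷ w) = begin
    suc (length w)                    ≡⟨ +-comm 1 (length w) ⟩
    length w + 1                      ≤⟨ +-mono-≤ (length≤length-Θ w) (1≤length-Θ-letter a) ⟩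
    length (Θ w) + length (Θ [ a ])   ≡⟨ sym (length-++ (Θ w)) ⟩
    length (Θ w ++ Θ [ a ])           ≡⟨ cong length (sym (anti [ a ] w)) ⟩
    length (Θ (a ∷ w))                ∎
    where open ≤-Reasoning

  length-Θ : ∀ w → length (Θ w) ≡ length w
  length-Θ w = ≤-antisym (subst (λ v → length (Θ w) ≤ length v) (inv w) (length≤length-Θ (Θ w)))
                         (length≤length-Θ w)

morphism-fixes-no-nonempty : ∀ {k} (Φ : Word k → Word k) →
  IsMorphism Φ → (∀ w → length (Φ w) ≡ length w) → (∀ a → Φ [ a ] ≢ [ a ]) →
  ∀ {w} → 1 ≤ length w → Φ w ≢ w
morphism-fixes-no-nonempty Φ hom len nofix {a ∷ w} _ Φw≡w =
  nofix a (proj₁ (++-injective (Φ [ a ]) [ a ] (len [ a ]) (trans (sym (hom [ a ] w)) Φw≡w)))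

length-enumerated : ∀ {k m w} {u : Word∞ k} {M : List (Word k)} →
                    Enumerates u m M → w ∈ M → length w ≡ m
length-enumerated enum w∈ = proj₁ (Equivalence.to (proj₂ enum _) w∈)

module KleinAction {k} (Θ₁ Θ₂ : Word k → Word k)
  (anti₁ : IsAntimorphism Θ₁) (inv₁ : IsInvolutive Θ₁)
  (anti₂ : IsAntimorphism Θ₂) (inv₂ : IsInvolutive Θ₂)
  (comm : ∀ w → Θ₁ (Θ₂ w) ≡ Θ₂ (Θ₁ w)) where

  open InvolutiveAntimorphism Θ₁ anti₁ inv₁ using () renaming (length-Θ to length-Θ₁)
  open InvolutiveAntimorphism Θ₂ anti₂ inv₂ using () renaming (length-Θ to length-Θ₂)

  act : G → Word k → Word k
  act (b₁ , b₂) w = (Θ₁ ^ᵇ b₁) ((Θ₂ ^ᵇ b₂) w)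

  act-· : ∀ g h w → act (g · h) w ≡ act g (act h w)
  act-· (b₁ , b₂) (c₁ , c₂) w = begin
    (Θ₁ ^ᵇ (b₁ xor c₁)) ((Θ₂ ^ᵇ (b₂ xor c₂)) w)
      ≡⟨ cong (Θ₁ ^ᵇ (b₁ xor c₁)) (^ᵇ-xor inv₂ b₂ c₂ w) ⟩
    (Θ₁ ^ᵇ (b₁ xor c₁)) ((Θ₂ ^ᵇ b₂) ((Θ₂ ^ᵇ c₂) w))
      ≡⟨ ^ᵇ-xor inv₁ b₁ c₁ _ ⟩
    (Θ₁ ^ᵇ b₁) ((Θ₁ ^ᵇ c₁) ((Θ₂ ^ᵇ b₂) ((Θ₂ ^ᵇ c₂) w)))
      ≡⟨ cong (Θ₁ ^ᵇ b₁) (^ᵇ-comm comm c₁ b₂ _) ⟩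
    (Θ₁ ^ᵇ b₁) ((Θ₂ ^ᵇ b₂) ((Θ₁ ^ᵇ c₁) ((Θ₂ ^ᵇ c₂) w))) ∎
    where open ≡-Reasoning

  act-involutive : ∀ g w → act g (act g w) ≡ w
  act-involutive g w = trans (sym (act-· g g w)) (cong (λ h → act h w) (·-self g))

  act-comm : ∀ g h w → act g (act h w) ≡ act h (act g w)
  act-comm g h w = trans (sym (act-· g h w)) (trans (cong (λ x → act x w) (·-comm g h)) (act-· h g w))

  act-preserves : (P : Word k → Set) → (∀ {w} → P w → P (Θ₁ w)) → (∀ {w} → P w → P (Θ₂ w)) →
                  ∀ g {w} → P w → P (act g w)
  act-preserves P pres₁ pres₂ (b₁ , b₂) = ^ᵇ-preserves P pres₁ b₁ ∘ ^ᵇ-preserves P pres₂ b₂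

  length-act : ∀ g w → length (act g w) ≡ length w
  length-act g w = act-preserves (λ v → length v ≡ length w)
                     (λ {v} eq → trans (length-Θ₁ v) eq) (λ {v} eq → trans (length-Θ₂ v) eq) g refl

  _∼_ : Word k → Word k → Set
  w ∼ y = ∃ λ g → act g w ≡ y

  _∼?_ : ∀ w y → Dec (w ∼ y)
  w ∼? y = ∃-G? λ g → act g w ≟ y

  ∼-sym : ∀ {w y} → w ∼ y → y ∼ w
  ∼-sym {w} (g , refl) = g , act-involutive g w

  ∼-trans : ∀ {w y z} → w ∼ y → y ∼ z → w ∼ z
  ∼-trans {w} (g , refl) (h , refl) = h · g , act-· h g w

  fixed-along-orbit : ∀ g {w y} → act g w ≡ w → w ∼ y → act g y ≡ y
  fixed-along-orbit g {w} fixed (h , refl) = trans (act-comm g h w) (cong (act h) fixed)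

  mult : Word k → Word k → ℕ
  mult w y = ∑G λ g → 𝟙 (act g w ≟ y)

  pal₁ pal₂ free : Word k → ℕ
  pal₁ w = 𝟙 (Θ₁ w ≟ w)
  pal₂ w = 𝟙 (Θ₂ w ≟ w)
  free w = 𝟙 (¬? ((Θ₁ w ≟ w) ⊎-dec (Θ₂ w ≟ w)))

  mult-≁ : ∀ {w y} → ¬ w ∼ y → mult w y ≡ 0
  mult-≁ {w} {y} w≁y = ∑G-cong λ g → 𝟙-no (act g w ≟ y) (λ eq → w≁y (g , eq))

  mult-∼ : ∀ {w y} → w ∼ y → mult w y ≡ mult w w
  mult-∼ {w} (h , refl) =
    trans (∑G-cong λ g → 𝟙-cong (act g w ≟ act h w) (act (h · g) w ≟ w) to from)
          (∑G-· h λ g → 𝟙 (act g w ≟ w))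
    where
    to : ∀ {g} → act g w ≡ act h w → act (h · g) w ≡ w
    to {g} eq = trans (act-· h g w) (trans (cong (act h) eq) (act-involutive h w))
    from : ∀ {g} → act (h · g) w ≡ w → act g w ≡ act h w
    from {g} eq = trans (sym (act-involutive h (act g w))) (cong (act h) (trans (sym (act-· h g w)) eq))

  mult-self : ∀ {w} → Θ₁ (Θ₂ w) ≢ w → mult w w ≡ 1 + pal₁ w + pal₂ w
  mult-self {w} nofix = begin
    𝟙 (w ≟ w) + pal₂ w + (pal₁ w + 𝟙 (Θ₁ (Θ₂ w) ≟ w))
      ≡⟨ cong₂ (λ a b → a + pal₂ w + (pal₁ w + b)) (𝟙-yes (w ≟ w) refl) (𝟙-no (Θ₁ (Θ₂ w) ≟ w) nofix) ⟩
    1 + pal₂ w + (pal₁ w + 0)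
      ≡⟨ cong (λ a → suc (pal₂ w + a)) (+-identityʳ (pal₁ w)) ⟩
    1 + (pal₂ w + pal₁ w)
      ≡⟨ cong suc (+-comm (pal₂ w) (pal₁ w)) ⟩
    1 + pal₁ w + pal₂ w ∎
    where open ≡-Reasoning

  free≡1 : ∀ {w} → Θ₁ w ≢ w → Θ₂ w ≢ w → free w ≡ 1
  free≡1 {w} ¬pal₁ ¬pal₂ = 𝟙-yes (¬? ((Θ₁ w ≟ w) ⊎-dec (Θ₂ w ≟ w)))
                                 λ { (inj₁ pal) → ¬pal₁ pal ; (inj₂ pal) → ¬pal₂ pal }

  free+pal₁+pal₂≡1 : ∀ {w} → Θ₁ (Θ₂ w) ≢ w → free w + pal₁ w + pal₂ w ≡ 1
  free+pal₁+pal₂≡1 {w} nofix = count (Θ₁ w ≟ w) (Θ₂ w ≟ w)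
    where
    count : (d₁ : Dec (Θ₁ w ≡ w)) (d₂ : Dec (Θ₂ w ≡ w)) → 𝟙 (¬? (d₁ ⊎-dec d₂)) + 𝟙 d₁ + 𝟙 d₂ ≡ 1
    count (yes p₁) (yes p₂) = contradiction (trans (cong Θ₁ p₂) p₁) nofix
    count (yes _)  (no _)   = refl
    count (no _)   (yes _)  = refl
    count (no _)   (no _)   = refl

  -- Each g ∈ G sends exactly one element of M to y, namely g y.
  ∑-mult : ∀ {M y} → Unique M → (∀ g → act g y ∈ M) → ∑[ w ∈ M ] mult w y ≡ 4
  ∑-mult {M} {y} uniq closed = trans (∑-∑G M (λ w g → 𝟙 (act g w ≟ y))) (∑G-cong λ g →
    trans (∑-cong M λ {w} _ → 𝟙-cong (act g w ≟ y) (w ≟ act g y)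
                                (λ eq → trans (sym (act-involutive g w)) (cong (act g) eq))
                                (λ eq → trans (cong (act g) eq) (act-involutive g y)))
          (∑-𝟙-∈ _≟_ M uniq (closed g)))

  module _ {M : List (Word k)} (nofix : ∀ {w} → w ∈ M → Θ₁ (Θ₂ w) ≢ w) where

    ∑-mult-self : ∑[ w ∈ M ] mult w w ≡ length M + palCount Θ₁ M + palCount Θ₂ M
    ∑-mult-self = begin
      ∑[ w ∈ M ] mult w w                          ≡⟨ ∑-cong M (mult-self ∘ nofix) ⟩
      ∑[ w ∈ M ] (1 + pal₁ w + pal₂ w)             ≡⟨ ∑-+ M (λ w → 1 + pal₁ w) pal₂ ⟩
      ∑[ w ∈ M ] (1 + pal₁ w) + ∑ M pal₂           ≡⟨ cong (_+ ∑ M pal₂) (∑-+ M (λ _ → 1) pal₁) ⟩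
      ∑[ w ∈ M ] 1 + ∑ M pal₁ + ∑ M pal₂           ≡⟨ cong₂ (λ a b → a + b + ∑ M pal₂) (∑-one M)
                                                           (sym (length-filter≡∑𝟙 (λ w → Θ₁ w ≟ w) M)) ⟩
      length M + palCount Θ₁ M + ∑ M pal₂          ≡⟨ cong (length M + palCount Θ₁ M +_)
                                                           (sym (length-filter≡∑𝟙 (λ w → Θ₂ w ≟ w) M)) ⟩
      length M + palCount Θ₁ M + palCount Θ₂ M     ∎
      where open ≡-Reasoning

    ∑-free+palCounts : ∑ M free + palCount Θ₁ M + palCount Θ₂ M ≡ length M
    ∑-free+palCounts = begin
      ∑ M free + palCount Θ₁ M + palCount Θ₂ M
        ≡⟨ cong₂ (λ a b → ∑ M free + a + b) (length-filter≡∑𝟙 (λ w → Θ₁ w ≟ w) M)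
                                            (length-filter≡∑𝟙 (λ w → Θ₂ w ≟ w) M) ⟩
      ∑ M free + ∑ M pal₁ + ∑ M pal₂
        ≡⟨ cong (_+ ∑ M pal₂) (sym (∑-+ M free pal₁)) ⟩
      ∑[ w ∈ M ] (free w + pal₁ w) + ∑ M pal₂
        ≡⟨ sym (∑-+ M (λ w → free w + pal₁ w) pal₂) ⟩
      ∑[ w ∈ M ] (free w + pal₁ w + pal₂ w)
        ≡⟨ ∑-cong M (free+pal₁+pal₂≡1 ∘ nofix) ⟩
      ∑[ w ∈ M ] 1
        ≡⟨ ∑-one M ⟩
      length M ∎
      where open ≡-Reasoning

  module RauzyWalk (u : Word∞ k) (closed₁ : ClosedUnder u Θ₁) (closed₂ : ClosedUnder u Θ₂) (n : ℕ) where

    vert edge : ℕ → Word k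
    vert i = window u i n
    edge i = window u i (suc n)

    length-window : ∀ i m → length (window u i m) ≡ m
    length-window i zero    = refl
    length-window i (suc m) = cong suc (length-window (suc i) m)

    window-snoc : ∀ i m → window u i (suc m) ≡ window u i m ++ [ u (i + m) ]
    window-snoc i zero    = cong (λ j → [ u j ]) (sym (+-identityʳ i))
    window-snoc i (suc m) = cong (u i ∷_) (begin
      window u (suc i) (suc m)                 ≡⟨ window-snoc (suc i) m ⟩
      window u (suc i) m ++ [ u (suc i + m) ]  ≡⟨ cong (λ j → window u (suc i) m ++ [ u j ]) (sym (+-suc i m)) ⟩
      window u (suc i) m ++ [ u (i + suc m) ]  ∎)
      where open ≡-Reasoning

    factor-window : ∀ i m → Factor u (window u i m)
    factor-window i m = i , cong (window u i) (sym (length-window i m))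

    factor-act : ∀ g {w} → Factor u w → Factor u (act g w)
    factor-act = act-preserves (Factor u) (closed₁ _) (closed₂ _)

    antimorphic-edge-prefix : ∀ Θ {t i} → IsAntimorphism Θ → (∀ w → length (Θ w) ≡ length w) →
                              Θ (edge t) ≡ edge i → Θ (vert (suc t)) ≡ vert i
    antimorphic-edge-prefix Θ {t} {i} anti len eq = proj₁ (++-injective (Θ (vert (suc t))) (vert i)
      (trans (len _) (trans (length-window (suc t) n) (sym (length-window i n))))
      (trans (sym (anti [ u t ] (vert (suc t)))) (trans eq (window-snoc i n))))

    morphic-edge-suffix : ∀ Φ {t i} → IsMorphism Φ → (∀ w → length (Φ w) ≡ length w) →
                          Φ (edge t) ≡ edge i → Φ (vert (suc t)) ≡ vert (suc i)
    morphic-edge-suffix Φ {t} hom len eq =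
      proj₂ (++-injective (Φ [ u t ]) [ _ ] (len [ u t ]) (trans (sym (hom [ u t ] (vert (suc t)))) eq))

    -- Antimorphisms swap the two ends of an edge, morphisms keep them in place.
    edge-orbit : ∀ {t i} → edge t ∼ edge i → vert (suc t) ∼ vert i ⊎ vert (suc t) ∼ vert (suc i)
    edge-orbit ((false , false) , eq) = inj₂ ((false , false) , ∷-injectiveʳ eq)
    edge-orbit ((true , false) , eq) = inj₁ ((true , false) , antimorphic-edge-prefix Θ₁ anti₁ length-Θ₁ eq)
    edge-orbit ((false , true) , eq) = inj₁ ((false , true) , antimorphic-edge-prefix Θ₂ anti₂ length-Θ₂ eq)
    edge-orbit ((true , true) , eq) =
      inj₂ ((true , true) , morphic-edge-suffix (Θ₁ ∘ Θ₂) (antimorphism-∘ Θ₁ Θ₂ anti₁ anti₂)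
                                                (length-act (true , true)) eq)

    fixed-edge-is-loop : ∀ {e t} → Θ₁ e ≡ e ⊎ Θ₂ e ≡ e → e ∼ edge t → vert (suc t) ∼ vert t
    fixed-edge-is-loop (inj₁ pal) o =
      (true , false) , antimorphic-edge-prefix Θ₁ anti₁ length-Θ₁ (fixed-along-orbit (true , false) pal o)
    fixed-edge-is-loop (inj₂ pal) o =
      (false , true) , antimorphic-edge-prefix Θ₂ anti₂ length-Θ₂ (fixed-along-orbit (false , true) pal o)

    Seen : ℕ → Word k → Set
    Seen zero    w = w ∼ vert 0
    Seen (suc T) w = Seen T w ⊎ w ∼ vert (suc T)

    seen? : ∀ T w → Dec (Seen T w)
    seen? zero    w = w ∼? vert 0
    seen? (suc T) w = seen? T w ⊎-dec w ∼? vert (suc T)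

    SeenEdge : ℕ → Word k → Set
    SeenEdge zero    e = ⊥
    SeenEdge (suc T) e = SeenEdge T e ⊎ e ∼ edge T

    seen-last : ∀ T {w} → w ∼ vert T → Seen T w
    seen-last zero    o = o
    seen-last (suc T) o = inj₂ o

    seen-∼ : ∀ T {w y} → w ∼ y → Seen T y → Seen T w
    seen-∼ zero    o s        = ∼-trans o s
    seen-∼ (suc T) o (inj₁ s) = inj₁ (seen-∼ T o s)
    seen-∼ (suc T) o (inj₂ s) = inj₂ (∼-trans o s)

    seen-mono : ∀ {i T w} → i ≤ T → Seen i w → Seen T w
    seen-mono i≤T = go (≤⇒≤′ i≤T)
      where
      go : ∀ {i T w} → i ≤′ T → Seen i w → Seen T w
      go ≤′-refl       s = s
      go (≤′-step i≤T) s = inj₁ (go i≤T s)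

    seenEdge⇒seen : ∀ T {e t} → e ∼ edge t → SeenEdge T e → Seen T (vert (suc t))
    seenEdge⇒seen (suc T) o (inj₁ s)  = inj₁ (seenEdge⇒seen T o s)
    seenEdge⇒seen (suc T) o (inj₂ o′) with edge-orbit (∼-trans (∼-sym o) o′)
    ... | inj₁ back    = inj₁ (seen-last T back)
    ... | inj₂ forward = inj₂ forward

    ifNew : {P : Set} → Dec P → ℕ → ℕ
    ifNew (yes _) _ = 0
    ifNew (no _)  m = m

    ifNew-zero : {P : Set} (d : Dec P) {m : ℕ} → m ≡ 0 → ifNew d m ≡ 0
    ifNew-zero (yes _) _  = refl
    ifNew-zero (no _)  eq = eq

    ∑-ifNew : {P : Set} (d : Dec P) (M : List (Word k)) (f : Word k → ℕ) →
              ∑[ w ∈ M ] ifNew d (f w) ≡ ifNew d (∑ M f)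
    ∑-ifNew (yes _) M f = ∑-zero M
    ∑-ifNew (no _)  M f = refl

    -- Each first visit of an orbit, at vert (suc T), is entered through edge T; the tallies
    -- record, for every first visit, the multiplicities of the vertex orbit and of that edge's orbit.
    vertexTally edgeTally : ℕ → Word k → ℕ
    vertexTally zero    w = mult w (vert 0)
    vertexTally (suc T) w = vertexTally T w + ifNew (seen? T (vert (suc T))) (mult w (vert (suc T)))
    edgeTally   zero    e = 0
    edgeTally   (suc T) e = edgeTally T e + ifNew (seen? T (vert (suc T))) (mult e (edge T))

    mult-self≤vertexTally : ∀ T {w} → Seen T w → mult w w ≤ vertexTally T w
    mult-self≤vertexTally zero    o        = ≤-reflexive (sym (mult-∼ o))
    mult-self≤vertexTally (suc T) (inj₁ s) = ≤-trans (mult-self≤vertexTally T s) (m≤m+n _ _)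
    mult-self≤vertexTally (suc T) {w} (inj₂ o) with seen? T (vert (suc T))
    ... | yes s = ≤-trans (mult-self≤vertexTally T (seen-∼ T o s)) (m≤m+n _ _)
    ... | no _  = ≤-trans (≤-reflexive (sym (mult-∼ o))) (m≤n+m _ (vertexTally T w))

    edgeTally-unseen : ∀ T {e} → ¬ SeenEdge T e → edgeTally T e ≡ 0
    edgeTally-unseen zero    unseen = refl
    edgeTally-unseen (suc T) unseen =
      cong₂ _+_ (edgeTally-unseen T (unseen ∘ inj₁)) (ifNew-zero (seen? T _) (mult-≁ (unseen ∘ inj₂)))

    edgeTally≤free : ∀ T {e} → Θ₁ (Θ₂ e) ≢ e → edgeTally T e ≤ free e
    edgeTally≤free zero    nofix = z≤n
    edgeTally≤free (suc T) {e} nofix = step (seen? T (vert (suc T))) (e ∼? edge T)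
      where
      unchanged : ∀ {m} → m ≡ 0 → edgeTally T e + m ≤ free e
      unchanged refl = subst (_≤ free e) (sym (+-identityʳ _)) (edgeTally≤free T nofix)

      step : (d : Dec (Seen T (vert (suc T)))) → Dec (e ∼ edge T) →
             edgeTally T e + ifNew d (mult e (edge T)) ≤ free e
      step (yes _)     _        = unchanged refl
      step (no _)      (no e≁)  = unchanged (mult-≁ e≁)
      step (no unseen) (yes o) = ≤-reflexive (begin
        edgeTally T e + mult e (edge T)  ≡⟨ cong₂ _+_ (edgeTally-unseen T (unseen ∘ seenEdge⇒seen T o))
                                                      (mult-∼ o) ⟩
        mult e e                         ≡⟨ mult-self nofix ⟩
        1 + pal₁ e + pal₂ e              ≡⟨ cong₂ (λ a b → 1 + a + b) (𝟙-no (Θ₁ e ≟ e) ¬pal₁)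
                                                                     (𝟙-no (Θ₂ e ≟ e) ¬pal₂) ⟩
        1                                ≡⟨ sym (free≡1 ¬pal₁ ¬pal₂) ⟩
        free e                           ∎)
        where
        open ≡-Reasoning
        ¬pal₁ : Θ₁ e ≢ e
        ¬pal₁ pal = unseen (seen-last T (fixed-edge-is-loop (inj₁ pal) o))
        ¬pal₂ : Θ₂ e ≢ e
        ¬pal₂ pal = unseen (seen-last T (fixed-edge-is-loop (inj₂ pal) o))

    module _ {L L′ : List (Word k)} (enumL : Enumerates u n L) (enumL′ : Enumerates u (suc n) L′) where

      act-vert∈L : ∀ i g → act g (vert i) ∈ L
      act-vert∈L i g = Equivalence.from (proj₂ enumL _)
        (trans (length-act g _) (length-window i n) , factor-act g (factor-window i n))

      act-edge∈L′ : ∀ i g → act g (edge i) ∈ L′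
      act-edge∈L′ i g = Equivalence.from (proj₂ enumL′ _)
        (trans (length-act g _) (length-window i (suc n)) , factor-act g (factor-window i (suc n)))

      tally-sum : ∀ T → ∑ L (vertexTally T) ≡ 4 + ∑ L′ (edgeTally T)
      tally-sum zero    = trans (∑-mult (proj₁ enumL) (act-vert∈L 0)) (cong (4 +_) (sym (∑-zero L′)))
      tally-sum (suc T) = begin
        ∑[ w ∈ L ] (vertexTally T w + ifNew d (mult w (vert (suc T))))
          ≡⟨ ∑-+ L (vertexTally T) _ ⟩
        ∑ L (vertexTally T) + ∑[ w ∈ L ] ifNew d (mult w (vert (suc T)))
          ≡⟨ cong₂ _+_ (tally-sum T) (∑-ifNew d L _) ⟩
        4 + ∑ L′ (edgeTally T) + ifNew d (∑[ w ∈ L ] mult w (vert (suc T)))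
          ≡⟨ cong (λ s → 4 + ∑ L′ (edgeTally T) + ifNew d s)
                  (trans (∑-mult (proj₁ enumL) (act-vert∈L (suc T)))
                         (sym (∑-mult (proj₁ enumL′) (act-edge∈L′ T)))) ⟩
        4 + ∑ L′ (edgeTally T) + ifNew d (∑[ e ∈ L′ ] mult e (edge T))
          ≡⟨ +-assoc 4 (∑ L′ (edgeTally T)) _ ⟩
        4 + (∑ L′ (edgeTally T) + ifNew d (∑[ e ∈ L′ ] mult e (edge T)))
          ≡⟨ cong (4 +_) (sym (trans (∑-+ L′ (edgeTally T) _)
                                     (cong (∑ L′ (edgeTally T) +_) (∑-ifNew d L′ _)))) ⟩
        4 + ∑[ e ∈ L′ ] (edgeTally T e + ifNew d (mult e (edge T))) ∎
        where
        open ≡-Reasoning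
        d = seen? T (vert (suc T))

      all-seen : ∃ λ T → ∀ {w} → w ∈ L → Seen T w
      all-seen = uniform-bound seen-mono L λ {w} w∈ →
        let (len , i , w≡) = Equivalence.to (proj₂ enumL w) w∈
        in i , seen-last i ((false , false) , trans w≡ (cong (window u i) len))

      orbit-inequality : (∀ {w} → w ∈ L′ → Θ₁ (Θ₂ w) ≢ w) → ∑[ w ∈ L ] mult w w ≤ 4 + ∑ L′ free
      orbit-inequality nofix = begin
        ∑[ w ∈ L ] mult w w           ≤⟨ ∑-mono-≤ L (mult-self≤vertexTally T ∘ proj₂ all-seen) ⟩
        ∑ L (vertexTally T)           ≡⟨ tally-sum T ⟩
        4 + ∑ L′ (edgeTally T)        ≤⟨ +-monoʳ-≤ 4 (∑-mono-≤ L′ (edgeTally≤free T ∘ nofix)) ⟩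
        4 + ∑ L′ free                 ∎
        where
        open ≤-Reasoning
        T = proj₁ all-seen

corollary4 : (k : ℕ) (Θ₁ Θ₂ : List (Fin k) → List (Fin k)) (u : Word∞ k) →
    IsAntimorphism Θ₁ → IsInvolutive Θ₁ →
    IsAntimorphism Θ₂ → IsInvolutive Θ₂ →
    ¬ (∀ w → Θ₁ w ≡ Θ₂ w) →
    (∀ w → Θ₁ (Θ₂ w) ≡ Θ₂ (Θ₁ w)) →
    (∀ (a : Fin k) → ¬ (Θ₁ (Θ₂ [ a ]) ≡ [ a ])) →
    AllLettersOccur u →
    ClosedUnder u Θ₁ → ClosedUnder u Θ₂ →
    (n : ℕ) → 1 ≤ n →
    (L L′ : List (List (Fin k))) → Enumerates u n L → Enumerates u (suc n) L′ →
    length L + palCount Θ₁ L + palCount Θ₂ L + palCount Θ₁ L′ + palCount Θ₂ L′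
    ≤ length L′ + 4
corollary4 k Θ₁ Θ₂ u anti₁ inv₁ anti₂ inv₂ _ comm derangement _ closed₁ closed₂ n 1≤n L L′ enumL enumL′ =
  begin
    length L + P₁ L + P₂ L + P₁ L′ + P₂ L′
      ≡⟨ cong (λ s → s + P₁ L′ + P₂ L′) (sym (∑-mult-self nofixL)) ⟩
    ∑[ w ∈ L ] mult w w + P₁ L′ + P₂ L′
      ≤⟨ +-monoˡ-≤ _ (+-monoˡ-≤ _ (orbit-inequality enumL enumL′ nofixL′)) ⟩
    4 + ∑ L′ free + P₁ L′ + P₂ L′
      ≡⟨ trans (cong (_+ P₂ L′) (+-assoc 4 (∑ L′ free) (P₁ L′)))
               (+-assoc 4 (∑ L′ free + P₁ L′) (P₂ L′)) ⟩
    4 + (∑ L′ free + P₁ L′ + P₂ L′)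
      ≡⟨ cong (4 +_) (∑-free+palCounts nofixL′) ⟩
    4 + length L′
      ≡⟨ +-comm 4 _ ⟩
    length L′ + 4 ∎
  where
  open ≤-Reasoning
  open KleinAction Θ₁ Θ₂ anti₁ inv₁ anti₂ inv₂ comm
  open RauzyWalk u closed₁ closed₂ n
  P₁ P₂ : List (Word k) → ℕ
  P₁ = palCount Θ₁
  P₂ = palCount Θ₂
  nofix : ∀ {w} → 1 ≤ length w → Θ₁ (Θ₂ w) ≢ w
  nofix = morphism-fixes-no-nonempty (Θ₁ ∘ Θ₂) (antimorphism-∘ Θ₁ Θ₂ anti₁ anti₂)
                                     (length-act (true , true)) derangement
  nofixL : ∀ {w} → w ∈ L → Θ₁ (Θ₂ w) ≢ w
  nofixL w∈ = nofix (subst (1 ≤_) (sym (length-enumerated enumL w∈)) 1≤n)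
  nofixL′ : ∀ {w} → w ∈ L′ → Θ₁ (Θ₂ w) ≢ w
  nofixL′ w∈ = nofix (subst (1 ≤_) (sym (length-enumerated enumL′ w∈)) (s≤s z≤n))
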